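{- Let $D$ be an FDAG and let $V$ be a nonempty set of vertices of $D$ such that $\mathrm{child}(v)\subseteq V$ for every $v\in V$. Then the sub-multigraph $\Delta$ of $D$ induced by $V$ (vertices $V$ and all arcs of $D$ between vertices of $V$, with multiplicity) is an FDAG, and $\mathcal{R}^{ -1}(\Delta)$ is a forest of subtrees of $\mathcal{R}^{ -1}(D)$.
   Context: Trees are finite unordered rooted trees. In a directed multigraph, $\mathrm{child}(v)$ is the multiset of heads of arcs leaving $v$ (with multiplicity). For a vertex $v$ of a tree $T$, $T[v]$ is the subtree consisting of $v$ and all its descendants; $\mathrm{Sub}(T)$ is the set of such subtrees up to isomorphism. An irredundant forest is a finite set of trees none of which is isomorphic to a subtree of another. The DAG reduction $\mathcal{R}(F)$ has one vertex per isomorphism class of subtrees occurring in trees of $F$, with, from the class of $T[v]$ to a class $c'$, as many arcs as $v$ has children $u$ with $T[u]\in c'$; $\mathcal{R}$ is injective on irredundant forests and $\mathcal{R}^{ -1}$ denotes its inverse. An FDAG is a directed acyclic multigraph of the form $\mathcal{R}(F)$, $F$ an irredundant forest. Given forests $F$ and $f$, $f$ is a forest of subtrees of $F$ if for every $t\in f$ there exists $T\in F$ with $t\in\mathrm{Sub}(T)$. -}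

module Defs where

open import Data.Nat using (ℕ)
open import Data.Fin using (Fin; _≟_)
open import Data.Fin.Properties using (any?)
open import Data.List using (List; map; filter)
open import Data.List.Membership.Propositional using (_∈_)
open import Data.List.Relation.Unary.All using (All)
open import Data.List.Relation.Unary.Any using (Any)
open import Data.List.Relation.Unary.AllPairs using (AllPairs)
open import Data.List.Relation.Binary.Pointwise using (Pointwise)
open import Data.List.Relation.Binary.Permutation.Propositional using (_↭_)
open import Data.Product using (Σ; ∃; _×_)
open import Relation.Binary.PropositionalEquality using (_≡_)
open import Relation.Nullary using (¬_)

-- Finite unordered rooted trees: rose trees; the order of the children list
-- is irrelevant up to the isomorphism relation _≅_ below.
data Tree : Set where
  node : List Tree → Tree

children : Tree → List Tree
children (node ts) = ts

data _≅_ : Tree → Tree → Set where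
  node-iso : ∀ {ts vs us} → ts ↭ vs → Pointwise _≅_ vs us → node ts ≅ node us

data _⊑_ : Tree → Tree → Set where
  here  : ∀ {t} → t ⊑ t
  there : ∀ {t u ts} → t ⊑ u → u ∈ ts → t ⊑ node ts

_∈Sub_ : Tree → Tree → Set
t ∈Sub T = ∃ λ s → s ⊑ T × t ≅ s

Forest : Set
Forest = List Tree

Irredundant : Forest → Set
Irredundant F = AllPairs (λ s t → ¬ (s ∈Sub t) × ¬ (t ∈Sub s)) F

ForestOfSubtrees : Forest → Forest → Set
ForestOfSubtrees f F = All (λ t → Any (λ T → t ∈Sub T) F) f

-- Directed multigraph on vertex set Fin n: child v is the multiset (list up
-- to permutation) of heads of arcs leaving v, with multiplicity.
Multigraph : ℕ → Set
Multigraph n = Fin n → List (Fin n)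

-- D is (isomorphic to) the DAG reduction R(F): φ v names the isomorphism
-- class of subtrees represented by vertex v.
IsReduction : ∀ {n} → Forest → Multigraph n → Set
IsReduction {n} F D = Σ (Fin n → Tree) λ φ →
    (∀ v → Any (λ T → φ v ∈Sub T) F)
  × (∀ {T t} → T ∈ F → t ⊑ T → ∃ λ v → t ≅ φ v)
  × (∀ v w → φ v ≅ φ w → v ≡ w)
  × (∀ v → ∃ λ ws → Pointwise (λ t w → t ≅ φ w) (children (φ v)) ws × ws ↭ D v)

FDAG : ∀ {n} → Multigraph n → Set
FDAG D = ∃ λ F → Irredundant F × IsReduction F D

-- Vertex subset V given as an injective map ι : Fin m → Fin n.
InImage : ∀ {m n} → (Fin m → Fin n) → Fin n → Set
InImage ι w = ∃ λ j → ι j ≡ w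

IsInduced : ∀ {m n} → Multigraph n → (Fin m → Fin n) → Multigraph m → Set
IsInduced D ι Δ =
  ∀ i → map ι (Δ i) ↭ filter (λ w → any? (λ j → ι j ≟ w)) (D (ι i))

-- A reduction φ of D unfolds each vertex v into a tree whose children are, with
-- multiplicity, the unfoldings of the heads of the arcs leaving v, and it is
-- injective up to isomorphism. Since V is closed under children, φ restricted to V
-- is such an injective unfolding of Δ. Any injective unfolding of a multigraph G
-- exhibits G as an FDAG, the forest being the unfoldings of the roots of G: sizes
-- grow along arcs, so every vertex lies below a root; every subtree of the
-- unfolding of v is the unfolding of a vertex reachable from v, so by injectivity
-- a root's unfolding cannot occur inside another root's. Finally, two unfoldings
-- of the same graph agree, so every tree of R⁻¹(Δ) is the unfolding of a vertex
-- of V, hence a subtree of a tree of R⁻¹(D).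

module Submission where

open import Defs
open import Data.Nat using (ℕ; _<_)
open import Data.Fin using (Fin)
open import Data.List.Membership.Propositional using (_∈_)
open import Data.Product using (∃; _×_)
open import Relation.Binary.PropositionalEquality using (_≡_)

open import Data.Nat using (suc; _+_; _∸_; _≤_; s≤s)
open import Data.Nat.Properties using (≤-trans; m≤m+n; m≤n+m; ∸-monoʳ-<)
open import Data.Nat.Induction using (<-wellFounded)
open import Data.Nat.ListAction using (sum)
open import Data.Nat.ListAction.Properties using (sum-↭)
open import Data.Fin using (_≟_)
open import Data.Fin.Properties using (any?)
open import Data.List using (List; []; _∷_; map; filter; allFin)
open import Data.List.Membership.Propositional using (lose)
import Data.List.Membership.DecPropositional as DecMembership
open import Data.List.Membership.Propositional.Properties
  using (∈-map⁺; ∈-map⁻; ∈-filter⁺; ∈-allFin)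
open import Data.List.Properties using (filter-all)
open import Data.List.Relation.Unary.All as All using (All; []; _∷_)
open import Data.List.Relation.Unary.All.Properties using (all-filter)
open import Data.List.Relation.Unary.Any as Any using (here; there)
open import Data.List.Relation.Unary.AllPairs using (AllPairs; []; _∷_)
import Data.List.Relation.Unary.AllPairs.Properties as AllPairs
import Data.List.Relation.Unary.Unique.Propositional.Properties as Unique
open import Data.List.Relation.Binary.Pointwise using (Pointwise; []; _∷_)
open import Data.List.Relation.Binary.Pointwise.Properties using (symmetric; transitive)
open import Data.List.Relation.Binary.Permutation.Propositional
  using (_↭_; refl; prep; swap; trans; ↭-sym)
open import Data.List.Relation.Binary.Permutation.Propositional.Properties
  using (∈-resp-↭; map⁺; ↭-map-inv)
open import Data.Product using (_,_)
open import Data.Empty using (⊥-elim)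
open import Function using (_∘_; id)
open import Induction.WellFounded using (Acc; acc)
open import Relation.Binary.Construct.Closure.ReflexiveTransitive using (Star; ε; _◅_; _◅◅_)
open import Relation.Nullary using (¬_; Dec; yes; no; ¬?)
open import Relation.Binary.PropositionalEquality
  using (_≢_; refl; sym; cong; cong₂; subst; module ≡-Reasoning)
  renaming (trans to ≡-trans)

private
  variable
    A B : Set
    R : A → B → Set

Pointwise-∈ˡ : ∀ {xs ys x} → Pointwise R xs ys → x ∈ xs → ∃ λ y → y ∈ ys × R x y
Pointwise-∈ˡ (r ∷ rs) (here refl) = _ , here refl , r
Pointwise-∈ˡ (r ∷ rs) (there x∈) with Pointwise-∈ˡ rs x∈
... | y , y∈ , rxy = y , there y∈ , rxy

Pointwise-∈ʳ : ∀ {xs ys y} → Pointwise R xs ys → y ∈ ys → ∃ λ x → x ∈ xs × R x y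
Pointwise-∈ʳ rs = Pointwise-∈ˡ (symmetric id rs)

↭-Pointwise : ∀ {xs ys zs} → xs ↭ ys → Pointwise R ys zs
            → ∃ λ zs′ → Pointwise R xs zs′ × zs′ ↭ zs
↭-Pointwise refl rs = _ , rs , refl
↭-Pointwise (prep x p) (r ∷ rs) with ↭-Pointwise p rs
... | zs′ , rs′ , σ = _ , r ∷ rs′ , prep _ σ
↭-Pointwise (swap x y p) (ry ∷ rx ∷ rs) with ↭-Pointwise p rs
... | zs′ , rs′ , σ = _ , rx ∷ ry ∷ rs′ , swap _ _ σ
↭-Pointwise (trans p q) rs with ↭-Pointwise q rs
... | _ , rs₁ , σ₁ with ↭-Pointwise p rs₁
... | _ , rs₂ , σ₂ = _ , rs₂ , trans σ₂ σ₁

Pointwise-↭ : ∀ {xs ys zs} → Pointwise R xs ys → ys ↭ zs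
            → ∃ λ xs′ → xs ↭ xs′ × Pointwise R xs′ zs
Pointwise-↭ rs σ with ↭-Pointwise (↭-sym σ) (symmetric id rs)
... | xs′ , rs′ , τ = xs′ , ↭-sym τ , symmetric id rs′

Pointwise-mapʳ⁻ : ∀ {C : Set} {f : C → B} {xs} ys → Pointwise R xs (map f ys)
                → Pointwise (λ x y → R x (f y)) xs ys
Pointwise-mapʳ⁻ []       []       = []
Pointwise-mapʳ⁻ (y ∷ ys) (r ∷ rs) = r ∷ Pointwise-mapʳ⁻ ys rs

mutual
  ≅-refl : ∀ t → t ≅ t
  ≅-refl (node ts) = node-iso refl (≅*-refl ts)

  ≅*-refl : ∀ ts → Pointwise _≅_ ts ts
  ≅*-refl []       = []
  ≅*-refl (t ∷ ts) = ≅-refl t ∷ ≅*-refl ts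

mutual
  ≅-sym : ∀ {t u} → t ≅ u → u ≅ t
  ≅-sym (node-iso ts↭vs vs≅us) with Pointwise-↭ (≅*-sym vs≅us) (↭-sym ts↭vs)
  ... | _ , us↭ws , ws≅ts = node-iso us↭ws ws≅ts

  ≅*-sym : ∀ {ts us} → Pointwise _≅_ ts us → Pointwise _≅_ us ts
  ≅*-sym []       = []
  ≅*-sym (e ∷ es) = ≅-sym e ∷ ≅*-sym es

mutual
  ≅-trans : ∀ {t u w} → t ≅ u → u ≅ w → t ≅ w
  ≅-trans (node-iso ts↭vs vs≅us) (node-iso us↭xs xs≅ws)
    with ↭-Pointwise us↭xs xs≅ws
  ... | zs , us≅zs , zs↭ws with Pointwise-↭ (≅*-trans vs≅us us≅zs) zs↭ws
  ... | ys , vs↭ys , ys≅ws = node-iso (trans ts↭vs vs↭ys) ys≅ws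

  ≅*-trans : ∀ {ts us ws} → Pointwise _≅_ ts us → Pointwise _≅_ us ws → Pointwise _≅_ ts ws
  ≅*-trans []       []       = []
  ≅*-trans (e ∷ es) (f ∷ fs) = ≅-trans e f ∷ ≅*-trans es fs

node-children : ∀ t → node (children t) ≡ t
node-children (node ts) = refl

≅-children : ∀ {cs t} → node cs ≅ t → ∃ λ ds → cs ↭ ds × Pointwise _≅_ ds (children t)
≅-children (node-iso cs↭ds ds≅us) = _ , cs↭ds , ds≅us

children-≅ : ∀ {cs ds t} → cs ↭ ds → Pointwise _≅_ ds (children t) → node cs ≅ t
children-≅ {t = t} cs↭ds ds≅ = subst (node _ ≅_) (node-children t) (node-iso cs↭ds ds≅)

⊑-resp-≅ : ∀ {s t t′} → s ⊑ t → t ≅ t′ → ∃ λ s′ → s′ ⊑ t′ × s ≅ s′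
⊑-resp-≅ here e = _ , here , e
⊑-resp-≅ {t′ = t′} (there s⊑c c∈ts) e with ≅-children e
... | ds , ts↭ds , ds≅ with Pointwise-∈ˡ ds≅ (∈-resp-↭ ts↭ds c∈ts)
... | d , d∈ , c≅d with ⊑-resp-≅ s⊑c c≅d
... | s′ , s′⊑d , s≅s′ = s′ , subst (s′ ⊑_) (node-children t′) (there s′⊑d d∈) , s≅s′

∈Sub-respˡ-≅ : ∀ {t t′ T} → t ≅ t′ → t′ ∈Sub T → t ∈Sub T
∈Sub-respˡ-≅ t≅t′ (s , s⊑T , t′≅s) = s , s⊑T , ≅-trans t≅t′ t′≅s

∈Sub-respʳ-≅ : ∀ {t T T′} → t ∈Sub T → T ≅ T′ → t ∈Sub T′
∈Sub-respʳ-≅ (s , s⊑T , t≅s) T≅T′ with ⊑-resp-≅ s⊑T T≅T′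
... | s′ , s′⊑T′ , s≅s′ = s′ , s′⊑T′ , ≅-trans t≅s s≅s′

∈Sub-child : ∀ {t c T} → t ∈Sub c → c ∈ children T → t ∈Sub T
∈Sub-child {T = T} (s , s⊑c , t≅s) c∈ = s , subst (s ⊑_) (node-children T) (there s⊑c c∈) , t≅s

mutual
  size : Tree → ℕ
  size (node ts) = suc (sizes ts)

  sizes : List Tree → ℕ
  sizes []       = 0
  sizes (t ∷ ts) = size t + sizes ts

sizes≡sum : ∀ ts → sizes ts ≡ sum (map size ts)
sizes≡sum []       = refl
sizes≡sum (t ∷ ts) = cong (size t +_) (sizes≡sum ts)

sizes-resp-↭ : ∀ {ts us} → ts ↭ us → sizes ts ≡ sizes us
sizes-resp-↭ {ts} {us} ts↭us = begin
  sizes ts             ≡⟨ sizes≡sum ts ⟩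
  sum (map size ts)    ≡⟨ sum-↭ (map⁺ size ts↭us) ⟩
  sum (map size us)    ≡⟨ sym (sizes≡sum us) ⟩
  sizes us             ∎
  where open ≡-Reasoning

mutual
  size-resp-≅ : ∀ {t u} → t ≅ u → size t ≡ size u
  size-resp-≅ (node-iso ts↭vs vs≅us) = cong suc (≡-trans (sizes-resp-↭ ts↭vs) (sizes-resp-≅* vs≅us))

  sizes-resp-≅* : ∀ {ts us} → Pointwise _≅_ ts us → sizes ts ≡ sizes us
  sizes-resp-≅* []       = refl
  sizes-resp-≅* (e ∷ es) = cong₂ _+_ (size-resp-≅ e) (sizes-resp-≅* es)

size≤sizes : ∀ {t ts} → t ∈ ts → size t ≤ sizes ts
size≤sizes {ts = t ∷ ts} (here refl) = m≤m+n (size t) (sizes ts)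
size≤sizes {ts = t ∷ ts} (there t∈) = ≤-trans (size≤sizes t∈) (m≤n+m (sizes ts) (size t))

size-child : ∀ {c t} → c ∈ children t → size c < size t
size-child {t = node ts} c∈ = s≤s (size≤sizes c∈)

MatchedBy : ∀ {k} → (Fin k → Tree) → List Tree → List (Fin k) → Set
MatchedBy φ = Pointwise (λ t w → t ≅ φ w)

IsUnfolding : ∀ {k} → Multigraph k → (Fin k → Tree) → Set
IsUnfolding G φ = ∀ v → ∃ λ ws → MatchedBy φ (children (φ v)) ws × ws ↭ G v

Reach : ∀ {k} → Multigraph k → Fin k → Fin k → Set
Reach G = Star (λ v w → w ∈ G v)

module Unfolding {k} {G : Multigraph k} {φ : Fin k → Tree} (unfolds : IsUnfolding G φ) where

  ≅-matched : ∀ {cs v} → node cs ≅ φ v → ∃ λ ws → MatchedBy φ cs ws × ws ↭ G v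
  ≅-matched {v = v} cs≅φv with ≅-children cs≅φv | unfolds v
  ... | ds , cs↭ds , ds≅ | ws , ch≅ws , ws↭ with ↭-Pointwise cs↭ds (transitive ≅-trans ds≅ ch≅ws)
  ... | ws′ , cs≅ws′ , ws′↭ws = ws′ , cs≅ws′ , trans ws′↭ws ws↭

  matched-≅ : ∀ {cs xs v} → MatchedBy φ cs xs → xs ↭ G v → node cs ≅ φ v
  matched-≅ {v = v} cs≅xs xs↭ with unfolds v
  ... | ws , ch≅ws , ws↭ with Pointwise-↭ cs≅xs (trans xs↭ (↭-sym ws↭))
  ... | cs′ , cs↭cs′ , cs′≅ws = children-≅ cs↭cs′ (transitive ≅-trans cs′≅ws (symmetric ≅-sym ch≅ws))

  arc-child : ∀ {v w} → w ∈ G v → ∃ λ c → c ∈ children (φ v) × c ≅ φ w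
  arc-child {v} w∈ with unfolds v
  ... | ws , ch≅ws , ws↭ = Pointwise-∈ʳ ch≅ws (∈-resp-↭ (↭-sym ws↭) w∈)

  arc-size< : ∀ {v w} → w ∈ G v → size (φ w) < size (φ v)
  arc-size< {v} w∈ with arc-child w∈
  ... | c , c∈ , c≅φw = subst (_< size (φ v)) (size-resp-≅ c≅φw) (size-child c∈)

  reach-∈Sub : ∀ {v x} → Reach G v x → φ x ∈Sub φ v
  reach-∈Sub {v} ε = φ v , here , ≅-refl (φ v)
  reach-∈Sub (w∈ ◅ w→x) with arc-child w∈
  ... | c , c∈ , c≅φw = ∈Sub-child (∈Sub-respʳ-≅ (reach-∈Sub w→x) (≅-sym c≅φw)) c∈

  ⊑-reach : ∀ {s t v} → s ⊑ t → t ≅ φ v → ∃ λ x → Reach G v x × s ≅ φ x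
  ⊑-reach here t≅φv = _ , ε , t≅φv
  ⊑-reach (there s⊑c c∈ts) ts≅φv with ≅-matched ts≅φv
  ... | ws , ts≅ws , ws↭ with Pointwise-∈ˡ ts≅ws c∈ts
  ... | w , w∈ws , c≅φw with ⊑-reach s⊑c c≅φw
  ... | x , w→x , s≅φx = x , ∈-resp-↭ ws↭ w∈ws ◅ w→x , s≅φx

module _ {k} {G : Multigraph k} {φ ψ : Fin k → Tree}
         (φ-unfolds : IsUnfolding G φ) (ψ-unfolds : IsUnfolding G ψ) where

  mutual
    unfoldings-≅ : ∀ {t v} → t ≅ ψ v → t ≅ φ v
    unfoldings-≅ {node cs} cs≅ψv with Unfolding.≅-matched ψ-unfolds cs≅ψv
    ... | ws , cs≅ψws , ws↭ = Unfolding.matched-≅ φ-unfolds (unfoldings-≅* cs≅ψws) ws↭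

    unfoldings-≅* : ∀ {cs ws} → MatchedBy ψ cs ws → MatchedBy φ cs ws
    unfoldings-≅* []       = []
    unfoldings-≅* (e ∷ es) = unfoldings-≅ e ∷ unfoldings-≅* es

module Roots {k} {G : Multigraph k} {φ : Fin k → Tree}
             (φ-injective : ∀ v w → φ v ≅ φ w → v ≡ w) (unfolds : IsUnfolding G φ) where

  open Unfolding unfolds

  Root : Fin k → Set
  Root v = ¬ (∃ λ u → v ∈ G u)

  parent? : ∀ v → Dec (∃ λ u → v ∈ G u)
  parent? v = any? (λ u → DecMembership._∈?_ _≟_ v (G u))

  Root? : ∀ v → Dec (Root v)
  Root? v = ¬? (parent? v)

  roots : List (Fin k)
  roots = filter Root? (allFin k)

  -- Sizes of unfoldings grow along arcs and are bounded by S, so S ∸ size (φ v)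
  -- decreases when passing to a parent.
  S : ℕ
  S = sizes (map φ (allFin k))

  size≤S : ∀ v → size (φ v) ≤ S
  size≤S v = size≤sizes (∈-map⁺ φ (∈-allFin v))

  root-above : ∀ v → Acc _<_ (S ∸ size (φ v)) → ∃ λ r → r ∈ roots × Reach G r v
  root-above v (acc below) with parent? v
  ... | no  no-parent   = v , ∈-filter⁺ Root? (∈-allFin v) no-parent , ε
  ... | yes (u , v∈Gu) with root-above u (below (∸-monoʳ-< (arc-size< v∈Gu) (size≤S u)))
  ... | r , r∈ , r→u = r , r∈ , r→u ◅◅ (v∈Gu ◅ ε)

  reach-root : ∀ {r v} → Root r → Reach G v r → v ≡ r
  reach-root root ε = refl
  reach-root root (w∈ ◅ w→r) with reach-root root w→r
  ... | refl = ⊥-elim (root (_ , w∈))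

  root-∉Sub : ∀ {r v} → Root r → r ≢ v → ¬ (φ r ∈Sub φ v)
  root-∉Sub {r} {v} root r≢v (s , s⊑φv , φr≅s) with ⊑-reach s⊑φv (≅-refl (φ v))
  ... | x , v→x , s≅φx with φ-injective r x (≅-trans φr≅s s≅φx)
  ... | refl = r≢v (sym (reach-root root v→x))

  Separated : Fin k → Fin k → Set
  Separated u v = ¬ (φ u ∈Sub φ v) × ¬ (φ v ∈Sub φ u)

  roots-separated : ∀ {vs} → All Root vs → AllPairs _≢_ vs → AllPairs Separated vs
  roots-separated [] [] = []
  roots-separated (root-u ∷ roots-vs) (u≢vs ∷ vs≢) =
    All.zipWith (λ (root-v , u≢v) → root-∉Sub root-u u≢v , root-∉Sub root-v (u≢v ∘ sym)) (roots-vs , u≢vs)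
    ∷ roots-separated roots-vs vs≢

  roots-irredundant : Irredundant (map φ roots)
  roots-irredundant = AllPairs.map⁺ (roots-separated (all-filter Root? (allFin k))
                                                     (Unique.filter⁺ Root? (Unique.allFin⁺ k)))

  roots-reduction : IsReduction (map φ roots) G
  roots-reduction = φ , covered , closed , φ-injective , unfolds
    where
    covered : ∀ v → Any.Any (λ T → φ v ∈Sub T) (map φ roots)
    covered v with root-above v (<-wellFounded _)
    ... | r , r∈ , r→v = lose (∈-map⁺ φ r∈) (reach-∈Sub r→v)

    closed : ∀ {T t} → T ∈ map φ roots → t ⊑ T → ∃ λ v → t ≅ φ v
    closed T∈ t⊑T with ∈-map⁻ φ T∈
    ... | r , _ , refl with ⊑-reach t⊑T (≅-refl (φ r))
    ... | x , _ , t≅φx = x , t≅φx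

unfolding-FDAG : ∀ {k} {G : Multigraph k} {φ : Fin k → Tree}
               → (∀ v w → φ v ≅ φ w → v ≡ w) → IsUnfolding G φ → FDAG G
unfolding-FDAG φ-injective unfolds = _ , roots-irredundant , roots-reduction
  where open Roots φ-injective unfolds

IsRestriction : ∀ {n m} → Multigraph n → (Fin m → Fin n) → Multigraph m → Set
IsRestriction D ι Δ = ∀ i → map ι (Δ i) ↭ D (ι i)

IsInduced⇒IsRestriction : ∀ {n m} {D : Multigraph n} {ι : Fin m → Fin n} {Δ : Multigraph m}
  → (∀ i w → w ∈ D (ι i) → InImage ι w) → IsInduced D ι Δ → IsRestriction D ι Δ
IsInduced⇒IsRestriction {ι = ι} {Δ} closed induced i =
  subst (map ι (Δ i) ↭_) (filter-all _ (All.tabulate (closed i _))) (induced i)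

module _ {n m} {D : Multigraph n} {ι : Fin m → Fin n} {Δ : Multigraph m}
         (restriction : IsRestriction D ι Δ) where

  unfolding-restrict : ∀ {φ} → IsUnfolding D φ → IsUnfolding Δ (φ ∘ ι)
  unfolding-restrict unfolds i with unfolds (ι i)
  ... | us , ch≅us , us↭ with ↭-map-inv ι (trans (restriction i) (↭-sym us↭))
  ... | ws , refl , Δi↭ws = ws , Pointwise-mapʳ⁻ ws ch≅us , ↭-sym Δi↭ws

  restriction-FDAG : FDAG D → (∀ i j → ι i ≡ ι j → i ≡ j) → FDAG Δ
  restriction-FDAG (_ , _ , _ , _ , _ , φ-injective , unfolds) ι-injective =
    unfolding-FDAG (λ i j φιi≅φιj → ι-injective i j (φ-injective _ _ φιi≅φιj)) (unfolding-restrict unfolds)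

  restriction-ForestOfSubtrees : ∀ {F f} → IsReduction F D → IsReduction f Δ → ForestOfSubtrees f F
  restriction-ForestOfSubtrees (_ , φ-covers , _ , _ , φ-unfolds) (_ , _ , ψ-closed , _ , ψ-unfolds) =
    All.tabulate λ t∈f → let (i , t≅ψi) = ψ-closed t∈f here in
      Any.map (∈Sub-respˡ-≅ (unfoldings-≅ (unfolding-restrict φ-unfolds) ψ-unfolds t≅ψi)) (φ-covers (ι i))

proposition5p2 : ∀ {n m} (D : Multigraph n) → FDAG D
    → (ι : Fin m → Fin n) → (∀ i j → ι i ≡ ι j → i ≡ j)
    → 0 < m
    → (∀ i w → w ∈ D (ι i) → InImage ι w)
    → (Δ : Multigraph m) → IsInduced D ι Δ
    → FDAG Δ
      × (∀ F f → Irredundant F → IsReduction F D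
           → Irredundant f → IsReduction f Δ → ForestOfSubtrees f F)
proposition5p2 D D-FDAG ι ι-injective _ closed Δ induced =
  restriction-FDAG restriction D-FDAG ι-injective ,
  λ F f _ F-reduction _ f-reduction → restriction-ForestOfSubtrees restriction F-reduction f-reduction
  where
  restriction : IsRestriction D ι Δ
  restriction = IsInduced⇒IsRestriction {D = D} closed induced
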